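{- Let $P=A\cup B$ be a bipartite poset, let $Q$ be a non-empty balanced subposet of $P$, and let $Q=\{u_1,\dots,u_m\}\cup\{v_1,\dots,v_m\}$ be a matching of $Q$. Then $\operatorname{Idim}(P)\le m+\operatorname{Idim}(P-Q)$. Furthermore, if $Q$ is maximal (i.e. there is no pair $a\in A\setminus Q$, $b\in B\setminus Q$ with $a\parallel b$ in $P$), then $\operatorname{Idim}(P)\le m$.
   Context: A bipartite poset is a finite poset $P$ with a partition $P=A\cup B$ where $A\subseteq\operatorname{Min}(P)$ and $B\subseteq\operatorname{Max}(P)$ (elements that are both minimal and maximal may lie in either part); a subposet $Q$ inherits the partition $(Q\cap A)\cup(Q\cap B)$. $Q$ is balanced if $|Q\cap A|=|Q\cap B|$. A matching of a balanced $Q$ with $|Q|=2m$ is a labelling $Q=\{u_1,\dots,u_m\}\cup\{v_1,\dots,v_m\}$ with $u_i\in A$, $v_i\in B$ and $u_i\parallel v_i$ (incomparable) in $P$ for all $i$. The interval dimension $\operatorname{Idim}(P)$ is the least positive integer $d$ such that there are interval orders $P_1,\dots,P_d$ on the ground set of $P$ with $x<y$ in $P$ iff $x<y$ in every $P_i$; by convention $\operatorname{Idim}$ of the empty poset is $0$. For a bipartite poset $P=A\cup B$ it is known that $\operatorname{Idim}(P)$ equals the least positive integer $d$ for which there is a family of $d$ linear extensions of $P$ such that for every $(a,b)\in A\times B$ with $a\parallel b$ in $P$, some member $L$ of the family has $a>b$ in $L$. -}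

module Defs where

open import Data.Nat using (ℕ; _≤_)
open import Data.Fin using (Fin)
open import Data.Bool using (Bool; true; false)
open import Data.Product using (Σ; ∃; _×_)
open import Data.Sum using (_⊎_)
open import Data.Unit using (⊤)
open import Relation.Nullary using (¬_)
open import Relation.Binary.PropositionalEquality using (_≡_)

record BipartitePoset (n : ℕ) : Set₁ where
  field
    _<P_   : Fin n → Fin n → Set
    irrefl : ∀ x → ¬ (x <P x)
    trans  : ∀ {x y z} → x <P y → y <P z → x <P z
    inA    : Fin n → Bool
    A⊆Min  : ∀ x y → inA x ≡ true → ¬ (y <P x)
    B⊆Max  : ∀ x y → inA x ≡ false → ¬ (x <P y)

  _∥_ : Fin n → Fin n → Set
  x ∥ y = ¬ (x <P y) × ¬ (y <P x)

open BipartitePoset public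

Subset : ℕ → Set₁
Subset n = Fin n → Set

full : ∀ {n} → Subset n
full _ = ⊤

-- R, restricted to the subset S, is an interval order: a strict partial order
-- on S which is (2+2)-free.
IsIntervalOrderOn : ∀ {n} → Subset n → (Fin n → Fin n → Set) → Set
IsIntervalOrderOn S R =
    (∀ x → S x → ¬ R x x)
  × (∀ x y z → S x → S y → S z → R x y → R y z → R x z)
  × (∀ a b c d → S a → S b → S c → S d → R a b → R c d → R a d ⊎ R c b)

IntervalRealizer : ∀ {n} → BipartitePoset n → Subset n → ℕ → Set₁
IntervalRealizer {n} P S d =
  Σ (Fin d → Fin n → Fin n → Set) λ R →
      (∀ i → IsIntervalOrderOn S (R i))
    × (∀ x y → S x → S y → ((_<P_ P x y → ∀ i → R i x y) × ((∀ i → R i x y) → _<P_ P x y)))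

-- IsIdim P S d : d is the interval dimension of the subposet of P induced on S,
-- i.e. the least positive d admitting an interval realizer, with the convention
-- that the empty poset has interval dimension 0.
IsIdim : ∀ {n} → BipartitePoset n → Subset n → ℕ → Set₁
IsIdim P S d =
    ((∀ x → ¬ S x) → d ≡ 0)
  × ((∃ λ x → S x) →
        (1 ≤ d) × IntervalRealizer P S d
      × (∀ e → 1 ≤ e → IntervalRealizer P S e → d ≤ e))

-- Each matched pair (uᵢ , vᵢ) yields a biorder: every element of A below every
-- element of B, except that uᵢ only lies below its successors in P and vᵢ only
-- above its predecessors in P.  Since uᵢ ∥ vᵢ these are interval orders.  Each
-- interval order Rⱼ realizing P - Q extends to the whole ground set by putting
-- the matched elements of A at the bottom, those of B at the top, and Rⱼ in
-- between.  The m biorders separate every incomparable pair meeting Q, the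
-- extensions separate the pairs inside P - Q, and only pairs from A × B need
-- separating at all.  If Q is maximal, no pair inside P - Q needs separating,
-- so the biorders alone suffice; constructively this step needs the
-- comparabilities x < y, which we only know doubly negated, so the bound is
-- obtained through the stability of the decidable d ≤ m.
module Submission where

open import Defs hiding (trans)
open import Data.Nat using (ℕ; _≤_; _<_; _+_; z≤n; s≤s; _≤?_; _<?_)
open import Data.Nat.Properties using (≤-trans; ≤-antisym; ≤-reflexive; <⇒≤; ≮⇒≥; <-irrefl; ≤-<-trans; <-≤-trans; +-identityʳ; m≤m+n)
open import Data.Fin using (Fin; zero; suc; splitAt; join; fromℕ<)
open import Data.Fin.Properties using (any?; splitAt-join; ∀-cons) renaming (_≟_ to _≟ᶠ_)
open import Data.Bool using (true; false)
open import Data.Product using (_×_; ∃; _,_; proj₁; proj₂)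
open import Data.Sum using (_⊎_; inj₁; inj₂)
open import Data.Empty using (⊥-elim)
open import Data.Unit using (tt)
open import Function using (_∘_)
open import Relation.Nullary using (¬_; Dec; yes; no; contradiction)
open import Relation.Nullary.Decidable using (decidable-stable; _⊎-dec_)
open import Relation.Nullary.Negation using (¬¬-map)
open import Relation.Binary.PropositionalEquality using (_≡_; _≢_; refl; sym; trans; subst)
open import Function.Definitions using (Injective)

private
  variable
    n k : ℕ
    A B : Set

¬¬-→ : (A → ¬ ¬ B) → ¬ ¬ (A → B)
¬¬-→ f ¬[A→B] = ¬[A→B] (λ a → ⊥-elim (f a (λ b → ¬[A→B] (λ _ → b))))

¬¬-∀-Fin : {P : Fin n → Set} → (∀ i → ¬ ¬ P i) → ¬ ¬ (∀ i → P i)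
¬¬-∀-Fin {ℕ.zero} _ ¬∀ = ¬∀ (λ ())
¬¬-∀-Fin {ℕ.suc n} h ¬∀ = h zero (λ p₀ → ¬¬-∀-Fin (h ∘ suc) (λ ps → ¬∀ (∀-cons p₀ ps)))

<-≤-2+2 : ∀ {a b c d} → a < b → c ≤ d → a < d ⊎ c < b
<-≤-2+2 {a} {b} {c} {d} a<b c≤d with a <? d
... | yes a<d = inj₁ a<d
... | no a≮d = inj₂ (≤-<-trans (≤-trans c≤d (≮⇒≥ a≮d)) a<b)

≤-<-2+2 : ∀ {a b c d} → a ≤ b → c < d → a < d ⊎ c < b
≤-<-2+2 {a} {b} {c} {d} a≤b c<d with c <? b
... | yes c<b = inj₂ c<b
... | no c≮b = inj₁ (≤-<-trans (≤-trans a≤b (≮⇒≥ c≮b)) c<d)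

IsIntervalOrderOn-mono : {S T : Subset n} {R : Fin n → Fin n → Set}
  → (∀ x → T x → S x) → IsIntervalOrderOn S R → IsIntervalOrderOn T R
IsIntervalOrderOn-mono T⊆S (irrefl , trans , 2+2) =
    (λ x tx → irrefl x (T⊆S x tx))
  , (λ x y z tx ty tz → trans x y z (T⊆S x tx) (T⊆S y ty) (T⊆S z tz))
  , (λ a b c d ta tb tc td → 2+2 a b c d (T⊆S a ta) (T⊆S b tb) (T⊆S c tc) (T⊆S d td))

module Refinement (r : Fin n → ℕ) (ℓ : ℕ) (R : Fin n → Fin n → Set) where

  Refine : Fin n → Fin n → Set
  Refine x y = r x < r y ⊎ (r x ≡ ℓ × r y ≡ ℓ × R x y)

  Refine⇒≤ : ∀ {x y} → Refine x y → r x ≤ r y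
  Refine⇒≤ (inj₁ rx<ry) = <⇒≤ rx<ry
  Refine⇒≤ (inj₂ (rx≡ℓ , ry≡ℓ , _)) = ≤-reflexive (trans rx≡ℓ (sym ry≡ℓ))

  Refine-intro : ∀ {x y} → r x ≤ ℓ → ℓ ≤ r y → (r x ≡ ℓ → r y ≡ ℓ → R x y) → Refine x y
  Refine-intro {x} {y} rx≤ℓ ℓ≤ry level with r x <? r y
  ... | yes rx<ry = inj₁ rx<ry
  ... | no rx≮ry = inj₂ (rx≡ℓ , ry≡ℓ , level rx≡ℓ ry≡ℓ)
    where
    ry≤rx = ≮⇒≥ rx≮ry
    rx≡ℓ = ≤-antisym rx≤ℓ (≤-trans ℓ≤ry ry≤rx)
    ry≡ℓ = ≤-antisym (≤-trans ry≤rx rx≤ℓ) ℓ≤ry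

  Refine-level : ∀ {x y} → r x ≡ r y → Refine x y → R x y
  Refine-level rx≡ry (inj₁ rx<ry) = contradiction rx<ry (<-irrefl rx≡ry)
  Refine-level _ (inj₂ (_ , _ , xRy)) = xRy

  Refine-isIntervalOrder : IsIntervalOrderOn (λ x → r x ≡ ℓ) R → IsIntervalOrderOn full Refine
  Refine-isIntervalOrder (irrefl , trans′ , 2+2) = irreflexive , transitive , twoPlusTwoFree
    where
    irreflexive : ∀ x → full x → ¬ Refine x x
    irreflexive x _ (inj₁ rx<rx) = <-irrefl refl rx<rx
    irreflexive x _ (inj₂ (rx≡ℓ , _ , xRx)) = irrefl x rx≡ℓ xRx

    transitive : ∀ x y z → full x → full y → full z → Refine x y → Refine y z → Refine x z
    transitive x y z _ _ _ (inj₁ rx<ry) yz = inj₁ (<-≤-trans rx<ry (Refine⇒≤ yz))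
    transitive x y z _ _ _ (inj₂ xy) (inj₁ ry<rz) = inj₁ (≤-<-trans (Refine⇒≤ (inj₂ xy)) ry<rz)
    transitive x y z _ _ _ (inj₂ (rx≡ℓ , ry≡ℓ , xRy)) (inj₂ (_ , rz≡ℓ , yRz)) =
      inj₂ (rx≡ℓ , rz≡ℓ , trans′ x y z rx≡ℓ ry≡ℓ rz≡ℓ xRy yRz)

    twoPlusTwoFree : ∀ a b c d → full a → full b → full c → full d
      → Refine a b → Refine c d → Refine a d ⊎ Refine c b
    twoPlusTwoFree a b c d _ _ _ _ (inj₁ ra<rb) cd with <-≤-2+2 ra<rb (Refine⇒≤ cd)
    ... | inj₁ ra<rd = inj₁ (inj₁ ra<rd)
    ... | inj₂ rc<rb = inj₂ (inj₁ rc<rb)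
    twoPlusTwoFree a b c d _ _ _ _ (inj₂ ab) (inj₁ rc<rd) with ≤-<-2+2 (Refine⇒≤ (inj₂ ab)) rc<rd
    ... | inj₁ ra<rd = inj₁ (inj₁ ra<rd)
    ... | inj₂ rc<rb = inj₂ (inj₁ rc<rb)
    twoPlusTwoFree a b c d _ _ _ _ (inj₂ (ra≡ℓ , rb≡ℓ , aRb)) (inj₂ (rc≡ℓ , rd≡ℓ , cRd))
      with 2+2 a b c d ra≡ℓ rb≡ℓ rc≡ℓ rd≡ℓ aRb cRd
    ... | inj₁ aRd = inj₁ (inj₂ (ra≡ℓ , rd≡ℓ , aRd))
    ... | inj₂ cRb = inj₂ (inj₂ (rc≡ℓ , rb≡ℓ , cRb))

module _ (P : BipartitePoset n) where

  open BipartitePoset P using () renaming (_<P_ to _≺_)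

  <-source∈A : ∀ {x y} → x ≺ y → inA P x ≡ true
  <-source∈A {x} {y} x<y with inA P x in x∈?
  ... | true = refl
  ... | false = contradiction x<y (B⊆Max P x y x∈?)

  <-target∈B : ∀ {x y} → x ≺ y → inA P y ≡ false
  <-target∈B {x} {y} x<y with inA P y in y∈?
  ... | false = refl
  ... | true = contradiction x<y (A⊆Min P y x y∈?)

  A∩B-disjoint : ∀ {x} → inA P x ≡ true → ¬ (inA P x ≡ false)
  A∩B-disjoint x∈A x∈B = contradiction (trans (sym x∈A) x∈B) λ ()

  ¬∥⇒¬¬< : ∀ {x y} → inA P y ≡ false → ¬ (_∥_ P x y) → ¬ ¬ (x ≺ y)
  ¬∥⇒¬¬< y∈B ¬x∥y x≮y = ¬x∥y (x≮y , B⊆Max P _ _ y∈B)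

  Biorder : Fin n → Fin n → Fin n → Fin n → Set
  Biorder a b x y = inA P x ≡ true × inA P y ≡ false × (x ≺ y ⊎ (a ≢ x × b ≢ y))

  <⇒Biorder : ∀ {a b x y} → x ≺ y → Biorder a b x y
  <⇒Biorder x<y = <-source∈A x<y , <-target∈B x<y , inj₁ x<y

  Biorder-source : ∀ {a b x y} → a ≡ x → Biorder a b x y → x ≺ y
  Biorder-source _ (_ , _ , inj₁ x<y) = x<y
  Biorder-source a≡x (_ , _ , inj₂ (a≢x , _)) = contradiction a≡x a≢x

  Biorder-target : ∀ {a b x y} → b ≡ y → Biorder a b x y → x ≺ y
  Biorder-target _ (_ , _ , inj₁ x<y) = x<y
  Biorder-target b≡y (_ , _ , inj₂ (_ , b≢y)) = contradiction b≡y b≢y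

  Biorder-2+2 : ∀ {a b} → ¬ (a ≺ b) → ∀ {x y z w}
    → Biorder a b x y → Biorder a b z w → Biorder a b x w ⊎ Biorder a b z y
  Biorder-2+2 {a} {b} a≮b {x} {y} {z} {w} xy@(x∈A , y∈B , _) zw@(z∈A , w∈B , _)
    with a ≟ᶠ x | b ≟ᶠ w
  ... | no a≢x | no b≢w = inj₁ (x∈A , w∈B , inj₂ (a≢x , b≢w))
  ... | yes refl | _ with a ≟ᶠ z
  ...   | yes refl = inj₁ zw
  ...   | no a≢z = inj₂ (z∈A , y∈B , inj₂ (a≢z , λ { refl → a≮b (Biorder-source refl xy) }))
  Biorder-2+2 {a} {b} a≮b {x} {y} {z} {w} xy@(x∈A , y∈B , _) zw@(z∈A , w∈B , _)
    | no a≢x | yes refl with b ≟ᶠ y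
  ...   | yes refl = inj₁ xy
  ...   | no b≢y = inj₂ (z∈A , y∈B , inj₂ ((λ { refl → a≮b (Biorder-target refl zw) }) , b≢y))

  -- Irreflexivity and transitivity hold vacuously: sources lie in A, targets in B.
  Biorder-isIntervalOrder : ∀ {a b} → ¬ (a ≺ b) → IsIntervalOrderOn full (Biorder a b)
  Biorder-isIntervalOrder a≮b =
      (λ { _ _ (x∈A , x∈B , _) → A∩B-disjoint x∈A x∈B })
    , (λ { _ _ _ _ _ _ (_ , y∈B , _) (y∈A , _) → ⊥-elim (A∩B-disjoint y∈A y∈B) })
    , (λ _ _ _ _ _ _ _ _ → Biorder-2+2 a≮b)

  CrossPair : Subset n → Fin n → Fin n → Set
  CrossPair S x y = S x × S y × inA P x ≡ true × inA P y ≡ false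

  -- Only pairs from A × B need to be separated, as in the characterisation of
  -- Idim for bipartite posets; this lets the empty family serve when Q is maximal.
  record CrossRealizer (S : Subset n) (k : ℕ) : Set₁ where
    field
      order           : Fin k → Fin n → Fin n → Set
      isIntervalOrder : ∀ j → IsIntervalOrderOn S (order j)
      sound           : ∀ x y → S x → S y → x ≺ y → ∀ j → order j x y
      complete        : ∀ x y → CrossPair S x y → (∀ j → order j x y) → x ≺ y

  intervalRealizer⇒crossRealizer : ∀ {S} → IntervalRealizer P S k → CrossRealizer S k
  intervalRealizer⇒crossRealizer (R , isIO , realizes) = record
    { order           = R
    ; isIntervalOrder = isIO
    ; sound           = λ x y sx sy → proj₁ (realizes x y sx sy)
    ; complete        = λ { x y (sx , sy , _) → proj₂ (realizes x y sx sy) }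
    }

  comparable⇒crossRealizer : ∀ {S} → (∀ x y → CrossPair S x y → x ≺ y) → CrossRealizer S 0
  comparable⇒crossRealizer comparable = record
    { order           = λ ()
    ; isIntervalOrder = λ ()
    ; sound           = λ _ _ _ _ _ ()
    ; complete        = λ x y xy _ → comparable x y xy
    }

  idim-minimal : ∀ {S d e} → IsIdim P S d → ∃ S → 1 ≤ e → IntervalRealizer P S e → d ≤ e
  idim-minimal (_ , nonempty) inhabited = proj₂ (proj₂ (nonempty inhabited)) _

module Matching (P : BipartitePoset n) (m : ℕ) (u v : Fin m → Fin n)
                (u∈A : ∀ i → inA P (u i) ≡ true) (v∈B : ∀ i → inA P (v i) ≡ false)
                (u≮v : ∀ i → ¬ (_<P_ P (u i) (v i))) where

  open BipartitePoset P using () renaming (_<P_ to _≺_)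

  Matched : Fin n → Set
  Matched x = ∃ λ i → (u i ≡ x) ⊎ (v i ≡ x)

  Unmatched : Subset n
  Unmatched x = ¬ Matched x

  matched? : ∀ x → Dec (Matched x)
  matched? x = any? (λ i → (u i ≟ᶠ x) ⊎-dec (v i ≟ᶠ x))

  unmatched? : ∀ x → Dec (Unmatched x)
  unmatched? x with matched? x
  ... | yes mx = no (λ ¬mx → ¬mx mx)
  ... | no ¬mx = yes ¬mx

  rank : Fin n → ℕ
  rank x with matched? x | inA P x
  ... | no _  | _     = 1
  ... | yes _ | true  = 0
  ... | yes _ | false = 2

  rank≡1⇒unmatched : ∀ x → rank x ≡ 1 → Unmatched x
  rank≡1⇒unmatched x _ with matched? x | inA P x
  rank≡1⇒unmatched x _  | no ¬mx | _ = ¬mx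
  rank≡1⇒unmatched x () | yes _ | true
  rank≡1⇒unmatched x () | yes _ | false

  unmatched⇒rank≡1 : ∀ {x} → Unmatched x → rank x ≡ 1
  unmatched⇒rank≡1 {x} ¬mx with matched? x
  ... | no _ = refl
  ... | yes mx = contradiction mx ¬mx

  rank-A : ∀ {x} → inA P x ≡ true → rank x ≤ 1
  rank-A {x} x∈A with matched? x | inA P x
  ... | no _  | _ = ≤-reflexive refl
  ... | yes _ | true = z≤n

  rank-B : ∀ {x} → inA P x ≡ false → 1 ≤ rank x
  rank-B {x} x∈B with matched? x | inA P x
  ... | no _  | _ = ≤-reflexive refl
  ... | yes _ | false = s≤s z≤n

  matched-source : ∀ {x y} → inA P x ≡ true → Matched x
    → (∀ i → Biorder P (u i) (v i) x y) → x ≺ y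
  matched-source _ (i , inj₁ uᵢ≡x) biorders = Biorder-source P uᵢ≡x (biorders i)
  matched-source x∈A (i , inj₂ refl) _ = ⊥-elim (A∩B-disjoint P x∈A (v∈B i))

  matched-target : ∀ {x y} → inA P y ≡ false → Matched y
    → (∀ i → Biorder P (u i) (v i) x y) → x ≺ y
  matched-target y∈B (i , inj₁ refl) _ = ⊥-elim (A∩B-disjoint P (u∈A i) y∈B)
  matched-target _ (i , inj₂ vᵢ≡y) biorders = Biorder-target P vᵢ≡y (biorders i)

  module Extension (i₀ : Fin m) (R : CrossRealizer P Unmatched k) where
    open CrossRealizer R
    open Refinement rank 1

    Component : Fin m ⊎ Fin k → Fin n → Fin n → Set
    Component (inj₁ i) = Biorder P (u i) (v i)
    Component (inj₂ j) = Refine (order j)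

    Component-isIntervalOrder : ∀ c → IsIntervalOrderOn full (Component c)
    Component-isIntervalOrder (inj₁ i) = Biorder-isIntervalOrder P (u≮v i)
    Component-isIntervalOrder (inj₂ j) =
      Refine-isIntervalOrder (order j)
        (IsIntervalOrderOn-mono rank≡1⇒unmatched (isIntervalOrder j))

    <⇒Component : ∀ {x y} → x ≺ y → ∀ c → Component c x y
    <⇒Component x<y (inj₁ i) = <⇒Biorder P x<y
    <⇒Component {x} {y} x<y (inj₂ j) =
      Refine-intro (order j) (rank-A (<-source∈A P x<y)) (rank-B (<-target∈B P x<y))
        (λ rx≡1 ry≡1 → sound x y (rank≡1⇒unmatched x rx≡1) (rank≡1⇒unmatched y ry≡1) x<y j)

    -- The biorder at i₀ puts x in A and y in B; this is where m ≥ 1 is needed.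
    Component⇒< : ∀ {x y} → (∀ c → Component c x y) → x ≺ y
    Component⇒< {x} {y} components with components (inj₁ i₀) | matched? x | matched? y
    ... | x∈A , _ , _ | yes mx | _ = matched-source x∈A mx (components ∘ inj₁)
    ... | _ , y∈B , _ | no _ | yes my = matched-target y∈B my (components ∘ inj₁)
    ... | x∈A , y∈B , _ | no ¬mx | no ¬my =
      complete x y (¬mx , ¬my , x∈A , y∈B) λ j →
        Refine-level (order j) (trans (unmatched⇒rank≡1 ¬mx) (sym (unmatched⇒rank≡1 ¬my)))
          (components (inj₂ j))

    extension : IntervalRealizer P full (m + k)
    extension = Component ∘ splitAt m
              , Component-isIntervalOrder ∘ splitAt m
              , λ x y _ _ → (λ x<y → <⇒Component x<y ∘ splitAt m)
                          , (λ all → Component⇒< λ c → subst (λ c → Component c x y)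
                                                             (splitAt-join m k c) (all (join m k c)))

  open Extension using (extension) public

lemma2p7 : ∀ {n} (P : BipartitePoset n) (m : ℕ) (u v : Fin m → Fin n)
    → 1 ≤ m
    → Injective _≡_ _≡_ u
    → Injective _≡_ _≡_ v
    → (∀ i → inA P (u i) ≡ true)
    → (∀ i → inA P (v i) ≡ false)
    → (∀ i → _∥_ P (u i) (v i))
    → (∀ d d' → IsIdim P full d
         → IsIdim P (λ x → ¬ (∃ λ i → (u i ≡ x) ⊎ (v i ≡ x))) d'
         → d ≤ m + d')
      × ((∀ a b → ¬ (∃ λ i → (u i ≡ a) ⊎ (v i ≡ a)) → ¬ (∃ λ i → (u i ≡ b) ⊎ (v i ≡ b))
            → inA P a ≡ true → inA P b ≡ false → ¬ (_∥_ P a b))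
         → ∀ d → IsIdim P full d → d ≤ m)
lemma2p7 P m u v 1≤m _ _ u∈A v∈B u∥v = idim≤m+idim , idim≤m
  where
  open Matching P m u v u∈A v∈B (proj₁ ∘ u∥v)
  i₀ : Fin m
  i₀ = fromℕ< 1≤m

  idim≤m+ : ∀ {d} → IsIdim P full d → CrossRealizer P Unmatched k → d ≤ m + k
  idim≤m+ {k = k} Idim R =
    idim-minimal P Idim (u i₀ , tt) (≤-trans 1≤m (m≤m+n m k)) (extension i₀ R)

  comparable⇒idim≤m : ∀ {d} → IsIdim P full d → (∀ x y → CrossPair P Unmatched x y → _<P_ P x y) → d ≤ m
  comparable⇒idim≤m Idim comparable =
    subst (_ ≤_) (+-identityʳ m) (idim≤m+ Idim (comparable⇒crossRealizer P comparable))

  idim≤m+idim : ∀ d d' → IsIdim P full d → IsIdim P Unmatched d' → d ≤ m + d'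
  idim≤m+idim d d' Idim Idim' with any? unmatched?
  ... | yes inhabited =
    idim≤m+ Idim (intervalRealizer⇒crossRealizer P (proj₁ (proj₂ (proj₂ Idim' inhabited))))
  ... | no empty =
    ≤-trans (comparable⇒idim≤m Idim λ x _ (ux , _) → contradiction (x , ux) empty) (m≤m+n m d')

  idim≤m : (∀ a b → Unmatched a → Unmatched b → inA P a ≡ true → inA P b ≡ false → ¬ (_∥_ P a b))
    → ∀ d → IsIdim P full d → d ≤ m
  idim≤m maximal d Idim = decidable-stable (d ≤? m) (¬¬-map (comparable⇒idim≤m Idim) ¬¬comparable)
    where
    ¬¬comparable : ¬ ¬ (∀ x y → CrossPair P Unmatched x y → _<P_ P x y)
    ¬¬comparable = ¬¬-∀-Fin λ x → ¬¬-∀-Fin λ y → ¬¬-→ λ { (ux , uy , x∈A , y∈B) →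
      ¬∥⇒¬¬< P y∈B (maximal x y ux uy x∈A y∈B) }
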